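{- For the star graph $S_n=K_{1,n-1}$ on $n$ vertices, $\gamma_s(S_n^{\frac{1}{2}})=n$.
   Context: All graphs are finite and simple. For a graph $G=(V,E)$, a set $D\subseteq V$ is a dominating set if every vertex of $V\setminus D$ is adjacent to at least one vertex of $D$. A dominating set $D$ is a secure dominating set if for every $u\in V\setminus D$ there exists $v\in D$ with $uv\in E$ such that $(D\setminus\{v\})\cup\{u\}$ is a dominating set of $G$. The secure domination number $\gamma_s(G)$ is the minimum cardinality of a secure dominating set of $G$. For $k\in\mathbb{N}$, the $k$-subdivision $G^{\frac{1}{k}}$ is the graph obtained from $G$ by replacing each edge $v_iv_j$ of $G$ by a path of length $k$ (with $k-1$ new internal vertices) joining $v_i$ and $v_j$. -}

module Defs where

open import Data.Bool using (Bool; true; false; _∧_; _∨_; not)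
open import Data.Nat using (ℕ; zero; suc; _+_; _≤_; _<ᵇ_)
open import Data.Fin using (Fin; zero; suc; toℕ; splitAt)
open import Data.Fin.Properties using (_≟_)
open import Data.Fin.Subset using (Subset; _∈_; _∉_; _∪_; _-_; ⁅_⁆; ∣_∣)
open import Data.List using (List; filterᵇ; cartesianProduct; allFin; length; lookup)
open import Data.Product using (_×_; _,_; proj₁; proj₂; ∃; Σ)
open import Data.Sum using (inj₁; inj₂)
open import Relation.Nullary.Decidable using (⌊_⌋)
open import Relation.Binary.PropositionalEquality using (_≡_)

-- A (simple) graph on the vertex set Fin n, given by its Boolean adjacency
-- function (assumed symmetric and irreflexive for the concrete graphs below).
Graph : ℕ → Set
Graph n = Fin n → Fin n → Bool

Adj : ∀ {n} → Graph n → Fin n → Fin n → Set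
Adj G u v = G u v ≡ true

Dominating : ∀ {n} → Graph n → Subset n → Set
Dominating G D = ∀ u → u ∉ D → ∃ λ v → v ∈ D × Adj G v u

SecureDominating : ∀ {n} → Graph n → Subset n → Set
SecureDominating G D =
  Dominating G D ×
  (∀ u → u ∉ D → ∃ λ v → v ∈ D × Adj G u v × Dominating G ((D - v) ∪ ⁅ u ⁆))

IsSecureDominationNumber : ∀ {n} → Graph n → ℕ → Set
IsSecureDominationNumber {n} G k =
  (∃ λ D → SecureDominating G D × ∣ D ∣ ≡ k) ×
  (∀ (D : Subset n) → SecureDominating G D → k ≤ ∣ D ∣)

edges : ∀ {n} → Graph n → List (Fin n × Fin n)
edges {n} G = filterᵇ (λ p → (toℕ (proj₁ p) <ᵇ toℕ (proj₂ p)) ∧ G (proj₁ p) (proj₂ p))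
                      (cartesianProduct (allFin n) (allFin n))

-- The 2-subdivision G^{1/2}: vertices are the n original vertices followed by
-- one new vertex per edge; the new vertex of edge ij is adjacent exactly to i and j.
subdivide2 : ∀ {n} (G : Graph n) → Graph (n + length (edges G))
subdivide2 {n} G x y with splitAt n x | splitAt n y
... | inj₁ _ | inj₁ _ = false
... | inj₂ _ | inj₂ _ = false
... | inj₁ v | inj₂ e = ⌊ v ≟ proj₁ (lookup (edges G) e) ⌋ ∨ ⌊ v ≟ proj₂ (lookup (edges G) e) ⌋
... | inj₂ e | inj₁ v = ⌊ v ≟ proj₁ (lookup (edges G) e) ⌋ ∨ ⌊ v ≟ proj₂ (lookup (edges G) e) ⌋

star : (n : ℕ) → Graph n
star _ zero    zero    = false
star _ zero    (suc _) = true
star _ (suc _) zero    = true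
star _ (suc _) (suc _) = false

-- The original vertices of any subdivided graph form a secure dominating set of it: the
-- subdivision vertex of an edge ab is defended by a, after which a is dominated by that
-- subdivision vertex and every other subdivision vertex still has an end different from a.
-- Conversely, in the subdivided star each leaf needs a guard in D (itself, or the subdivision
-- vertex next to it), and D contains one more vertex: the centre, or else the subdivision
-- vertex defending the centre, whose leaf must then lie in D because nothing else dominates
-- it after the swap.
module Submission where

open import Defs
open import Data.Bool using (Bool; true; T; _∧_; _∨_)
open import Data.Bool.Properties using (T-∧; T-≡)
open import Data.Empty using (⊥-elim)
open import Data.Fin using (Fin; zero; suc; toℕ; _↑ˡ_; _↑ʳ_; join; splitAt)
open import Data.Fin.Properties
  using (_≟_; 0≢1+n; suc-injective; splitAt-↑ˡ; splitAt-↑ʳ; join-splitAt; ↑ˡ-injective; ↑ʳ-injective)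
open import Data.Fin.Subset using (Subset; _∈_; _∉_; _∪_; _─_; _-_; ⁅_⁆; ∣_∣; ⊤; ⊥; inside; outside)
open import Data.Fin.Subset.Properties
  using (_∈?_; x∈p∪q⁺; x∈p∪q⁻; x∈⁅x⁆; x∈⁅y⁆⇒x≡y; p─q⊆p; x∈p∧x≢y⇒x∈p-y; x∈p⇒∣p-x∣<∣p∣; ∣⊥∣≡0)
open import Data.List using (List; lookup; length; cartesianProduct; allFin)
open import Data.List.Membership.Propositional.Properties using (∈-filter⁻; ∈-lookup)
import Data.List.Relation.Unary.All as All
open import Data.List.Relation.Unary.AllPairs using (_∷_)
open import Data.List.Relation.Unary.Unique.Propositional using (Unique)
import Data.List.Relation.Unary.Unique.Propositional.Properties as Unique
open import Data.Nat using (ℕ; zero; suc; _+_; _≤_; _<_; _<ᵇ_; z≤n; s≤s)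
open import Data.Nat.Properties using (≤-trans; <ᵇ⇒<; +-identityʳ; <-irrefl)
open import Data.Product using (_×_; _,_; proj₁; proj₂; ∃; map)
open import Data.Sum using (_⊎_; inj₁; inj₂)
open import Data.Vec using (_∷_; _++_; here; there)
open import Data.Vec.Properties using (lookup-++ˡ; lookup-replicate; lookup⇒[]=)
open import Function using (Injective; Equivalence; _⇔_; mk⇔; _∘_)
open import Relation.Nullary using (¬_; yes; no)
open import Relation.Nullary.Decidable using (T?; ⌊_⌋)
open import Relation.Binary.PropositionalEquality using (_≡_; _≢_; refl; sym; trans; cong; cong₂; subst)

private
  variable
    n k : ℕ

x∈p─q⇒x∉q : ∀ (p q : Subset n) {x} → x ∈ p ─ q → x ∉ q
x∈p─q⇒x∉q (inside ∷ p) (outside ∷ q) here         ()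
x∈p─q⇒x∉q (_      ∷ p) (_       ∷ q) (there x∈p─q) (there x∈q) = x∈p─q⇒x∉q p q x∈p─q x∈q

x∈p-y∪⁅u⁆⁻ : ∀ (p : Subset n) y u {x} → x ∈ (p - y) ∪ ⁅ u ⁆ → (x ∈ p × x ≢ y) ⊎ x ≡ u
x∈p-y∪⁅u⁆⁻ p y u x∈ with x∈p∪q⁻ (p - y) ⁅ u ⁆ x∈
... | inj₁ x∈p-y = inj₁ (p─q⊆p p ⁅ y ⁆ x∈p-y , λ { refl → x∈p─q⇒x∉q p ⁅ y ⁆ x∈p-y (x∈⁅x⁆ y) })
... | inj₂ x∈⁅u⁆ = inj₂ (x∈⁅y⁆⇒x≡y u x∈⁅u⁆)

x∈p-y∪⁅u⁆⁺ : ∀ {p : Subset n} {y x} u → x ∈ p → x ≢ y → x ∈ (p - y) ∪ ⁅ u ⁆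
x∈p-y∪⁅u⁆⁺ u x∈p x≢y = x∈p∪q⁺ (inj₁ (x∈p∧x≢y⇒x∈p-y x∈p x≢y))

u∈p-y∪⁅u⁆ : ∀ {p : Subset n} {y} u → u ∈ (p - y) ∪ ⁅ u ⁆
u∈p-y∪⁅u⁆ u = x∈p∪q⁺ (inj₂ (x∈⁅x⁆ u))

∣⊤++p∣≡k+∣p∣ : ∀ k (p : Subset n) → ∣ ⊤ {k} ++ p ∣ ≡ k + ∣ p ∣
∣⊤++p∣≡k+∣p∣ zero    p = refl
∣⊤++p∣≡k+∣p∣ (suc k) p = cong suc (∣⊤++p∣≡k+∣p∣ k p)

injective⇒≤∣p∣ : ∀ {p : Subset n} (f : Fin k → Fin n) → Injective _≡_ _≡_ f → (∀ i → f i ∈ p) → k ≤ ∣ p ∣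
injective⇒≤∣p∣ {k = zero}  f f-inj f∈p = z≤n
injective⇒≤∣p∣ {k = suc k} {p = p} f f-inj f∈p = ≤-trans (s≤s k≤∣p-f0∣) (x∈p⇒∣p-x∣<∣p∣ (f∈p zero))
  where
  k≤∣p-f0∣ : k ≤ ∣ p - f zero ∣
  k≤∣p-f0∣ = injective⇒≤∣p∣ (f ∘ suc) (suc-injective ∘ f-inj)
               (λ i → x∈p∧x≢y⇒x∈p-y (f∈p (suc i)) (λ eq → 0≢1+n (sym (f-inj eq))))

Unique⇒lookup-injective : ∀ {a} {A : Set a} {xs : List A} → Unique xs → Injective _≡_ _≡_ (lookup xs)
Unique⇒lookup-injective (_   ∷ _)   {zero}  {zero}  _  = refl
Unique⇒lookup-injective (x∉xs ∷ _)  {zero}  {suc j} eq = ⊥-elim (All.lookup x∉xs (∈-lookup j) eq)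
Unique⇒lookup-injective (x∉xs ∷ _)  {suc i} {zero}  eq = ⊥-elim (All.lookup x∉xs (∈-lookup i) (sym eq))
Unique⇒lookup-injective (_   ∷ xs!) {suc i} {suc j} eq = cong suc (Unique⇒lookup-injective xs! eq)

≟-∨-≟⇔ : ∀ (v a b : Fin n) → (⌊ v ≟ a ⌋ ∨ ⌊ v ≟ b ⌋) ≡ true ⇔ (v ≡ a ⊎ v ≡ b)
≟-∨-≟⇔ v a b with v ≟ a | v ≟ b
... | yes v≡a | _       = mk⇔ (λ _ → inj₁ v≡a) (λ _ → refl)
... | no  _   | yes v≡b = mk⇔ (λ _ → inj₂ v≡b) (λ _ → refl)
... | no  v≢a | no  v≢b = mk⇔ (λ ()) λ { (inj₁ v≡a) → ⊥-elim (v≢a v≡a) ; (inj₂ v≡b) → ⊥-elim (v≢b v≡b) }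

module Subdivision {n : ℕ} (G : Graph n) where

  E : ℕ
  E = length (edges G)

  H : Graph (n + E)
  H = subdivide2 G

  end₁ end₂ : Fin E → Fin n
  end₁ e = proj₁ (lookup (edges G) e)
  end₂ e = proj₂ (lookup (edges G) e)

  edge-valid : ∀ e → toℕ (end₁ e) < toℕ (end₂ e) × Adj G (end₁ e) (end₂ e)
  edge-valid e = map (<ᵇ⇒< _ _) (Equivalence.to T-≡) (Equivalence.to T-∧ passes-filter)
    where
    isEdge : Fin n × Fin n → Bool
    isEdge (a , b) = (toℕ a <ᵇ toℕ b) ∧ G a b
    passes-filter : T (isEdge (lookup (edges G) e))
    passes-filter = proj₂ (∈-filter⁻ (T? ∘ isEdge) {xs = cartesianProduct (allFin n) (allFin n)} (∈-lookup e))

  end₁≢end₂ : ∀ e → end₁ e ≢ end₂ e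
  end₁≢end₂ e eq = <-irrefl (cong toℕ eq) (proj₁ (edge-valid e))

  lookup-edges-injective : Injective _≡_ _≡_ (lookup (edges G))
  lookup-edges-injective = Unique⇒lookup-injective
    (Unique.filter⁺ _ (Unique.cartesianProduct⁺ (Unique.allFin⁺ n) (Unique.allFin⁺ n)))

  orig : Fin n → Fin (n + E)
  orig v = v ↑ˡ E

  sub : Fin E → Fin (n + E)
  sub e = n ↑ʳ e

  orig-injective : Injective _≡_ _≡_ orig
  orig-injective = ↑ˡ-injective E _ _

  sub-injective : Injective _≡_ _≡_ sub
  sub-injective = ↑ʳ-injective n _ _

  orig≢sub : ∀ v e → orig v ≢ sub e
  orig≢sub v e eq with trans (sym (splitAt-↑ˡ n v E)) (trans (cong (splitAt n) eq) (splitAt-↑ʳ n E e))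
  ... | ()

  data VertexView : Fin (n + E) → Set where
    original    : ∀ v → VertexView (orig v)
    subdividing : ∀ e → VertexView (sub e)

  vertexView : ∀ x → VertexView x
  vertexView x = subst VertexView (join-splitAt n E x) (view (splitAt n x))
    where
    view : ∀ s → VertexView (join n E s)
    view (inj₁ v) = original v
    view (inj₂ e) = subdividing e

  IsEnd : Fin n → Fin E → Set
  IsEnd v e = v ≡ end₁ e ⊎ v ≡ end₂ e

  orig-nonadjacent : ∀ v w → ¬ Adj H (orig v) (orig w)
  orig-nonadjacent v w rewrite splitAt-↑ˡ n v E | splitAt-↑ˡ n w E = λ ()

  orig-sub-adjacent : ∀ {v e} → IsEnd v e → Adj H (orig v) (sub e)
  orig-sub-adjacent {v} {e} v∈e rewrite splitAt-↑ˡ n v E | splitAt-↑ʳ n E e =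
    Equivalence.from (≟-∨-≟⇔ v (end₁ e) (end₂ e)) v∈e

  sub-orig-adjacent : ∀ {v e} → IsEnd v e → Adj H (sub e) (orig v)
  sub-orig-adjacent {v} {e} v∈e rewrite splitAt-↑ˡ n v E | splitAt-↑ʳ n E e =
    Equivalence.from (≟-∨-≟⇔ v (end₁ e) (end₂ e)) v∈e

  sub-orig-adjacent⁻ : ∀ {v e} → Adj H (sub e) (orig v) → IsEnd v e
  sub-orig-adjacent⁻ {v} {e} e~v rewrite splitAt-↑ˡ n v E | splitAt-↑ʳ n E e =
    Equivalence.to (≟-∨-≟⇔ v (end₁ e) (end₂ e)) e~v

  originals : Subset (n + E)
  originals = ⊤ {n} ++ ⊥ {E}

  orig∈originals : ∀ v → orig v ∈ originals
  orig∈originals v =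
    lookup⇒[]= (orig v) originals (trans (lookup-++ˡ (⊤ {n}) (⊥ {E}) v) (lookup-replicate v inside))

  ∣originals∣≡n : ∣ originals ∣ ≡ n
  ∣originals∣≡n = trans (∣⊤++p∣≡k+∣p∣ n (⊥ {E})) (trans (cong (n +_) (∣⊥∣≡0 E)) (+-identityʳ n))

  originals-dominating : Dominating H originals
  originals-dominating x x∉ with vertexView x
  ... | original v    = ⊥-elim (x∉ (orig∈originals v))
  ... | subdividing e = orig (end₁ e) , orig∈originals (end₁ e) , orig-sub-adjacent (inj₁ refl)

  originals-end₁-swap-dominating : ∀ e → Dominating H ((originals - orig (end₁ e)) ∪ ⁅ sub e ⁆)
  originals-end₁-swap-dominating e x x∉ with vertexView x
  ... | original v with v ≟ end₁ e
  ...   | yes refl = sub e , u∈p-y∪⁅u⁆ (sub e) , sub-orig-adjacent (inj₁ refl)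
  ...   | no  v≢a  = ⊥-elim (x∉ (x∈p-y∪⁅u⁆⁺ (sub e) (orig∈originals v) (v≢a ∘ orig-injective)))
  originals-end₁-swap-dominating e x x∉ | subdividing e′ with end₁ e′ ≟ end₁ e
  ... | no  a′≢a = orig (end₁ e′) , x∈p-y∪⁅u⁆⁺ (sub e) (orig∈originals (end₁ e′)) (a′≢a ∘ orig-injective)
                 , orig-sub-adjacent (inj₁ refl)
  ... | yes a′≡a = orig (end₂ e′) , x∈p-y∪⁅u⁆⁺ (sub e) (orig∈originals (end₂ e′)) b′≢a , orig-sub-adjacent (inj₂ refl)
    where
    b′≢a : orig (end₂ e′) ≢ orig (end₁ e)
    b′≢a eq = end₁≢end₂ e′ (trans a′≡a (sym (orig-injective eq)))

  originals-secure : SecureDominating H originals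
  originals-secure = originals-dominating , defend
    where
    defend : ∀ x → x ∉ originals →
             ∃ λ v → v ∈ originals × Adj H x v × Dominating H ((originals - v) ∪ ⁅ x ⁆)
    defend x x∉ with vertexView x
    ... | original v    = ⊥-elim (x∉ (orig∈originals v))
    ... | subdividing e = orig (end₁ e) , orig∈originals (end₁ e) , sub-orig-adjacent (inj₁ refl)
                        , originals-end₁-swap-dominating e

module SubdividedStar (m : ℕ) where

  open Subdivision (star (suc m)) public

  star-edge : ∀ {a b : Fin (suc m)} → toℕ a < toℕ b → Adj (star (suc m)) a b → ∃ λ j → a ≡ zero × b ≡ suc j
  star-edge {zero}  {suc j} _ _ = j , refl , refl
  star-edge {zero}  {zero}  _ ()
  star-edge {suc _} {suc _} _ ()

  edge-to-leaf : ∀ e → ∃ λ j → end₁ e ≡ zero × end₂ e ≡ suc j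
  edge-to-leaf e = star-edge (proj₁ (edge-valid e)) (proj₂ (edge-valid e))

  leafOf : Fin E → Fin m
  leafOf e = proj₁ (edge-to-leaf e)

  leafOf-injective : Injective _≡_ _≡_ leafOf
  leafOf-injective {e} {e′} eq with edge-to-leaf e | edge-to-leaf e′
  ... | _ , a≡0 , b≡j | _ , a′≡0 , b′≡j′ =
    lookup-edges-injective (cong₂ _,_ (trans a≡0 (sym a′≡0)) (trans b≡j (trans (cong suc eq) (sym b′≡j′))))

  centre : Fin (suc m + E)
  centre = orig zero

  leaf : Fin m → Fin (suc m + E)
  leaf j = orig (suc j)

  sub-leaf-adjacent⁻ : ∀ {e j} → Adj H (sub e) (leaf j) → leafOf e ≡ j
  sub-leaf-adjacent⁻ {e} e~j with sub-orig-adjacent⁻ e~j | edge-to-leaf e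
  ... | inj₁ j≡a | _ , a≡0 , _ = ⊥-elim (0≢1+n (trans (sym a≡0) (sym j≡a)))
  ... | inj₂ j≡b | _ , _ , b≡l = suc-injective (trans (sym b≡l) (sym j≡b))

  module _ {D : Subset (suc m + E)} (D-secure : SecureDominating H D) where

    -- A subdivision vertex guards its leaf only when the leaf itself is missing from D,
    -- so the subdivision vertex defending the centre guards nothing (see spare).
    Guards : Fin m → Fin (suc m + E) → Set
    Guards j x = x ≡ leaf j ⊎ (leaf j ∉ D × ∃ λ e → x ≡ sub e × leafOf e ≡ j)

    guard : ∀ j → ∃ λ x → x ∈ D × Guards j x
    guard j with leaf j ∈? D
    ... | yes j∈D = leaf j , j∈D , inj₁ refl
    ... | no  j∉D with proj₁ D-secure (leaf j) j∉D
    ...   | x , x∈D , x~j with vertexView x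
    ...     | original v    = ⊥-elim (orig-nonadjacent v (suc j) x~j)
    ...     | subdividing e = sub e , x∈D , inj₂ (j∉D , e , refl , sub-leaf-adjacent⁻ x~j)

    guards-unique : ∀ {i j x} → Guards i x → Guards j x → i ≡ j
    guards-unique (inj₁ refl) (inj₁ x≡j) = suc-injective (orig-injective x≡j)
    guards-unique (inj₁ refl) (inj₂ (_ , e , x≡e , _)) = ⊥-elim (orig≢sub _ e x≡e)
    guards-unique (inj₂ (_ , e , refl , _)) (inj₁ x≡j) = ⊥-elim (orig≢sub _ e (sym x≡j))
    guards-unique (inj₂ (_ , e , refl , refl)) (inj₂ (_ , e′ , x≡e′ , refl)) = cong leafOf (sub-injective x≡e′)

    defender-leaf∈D : ∀ e → Dominating H ((D - sub e) ∪ ⁅ centre ⁆) → leaf (leafOf e) ∈ D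
    defender-leaf∈D e swapped-dominating with leaf (leafOf e) ∈? D
    ... | yes ℓ∈D = ℓ∈D
    ... | no  ℓ∉D = ⊥-elim (undominated (swapped-dominating (leaf (leafOf e)) ℓ∉D′))
      where
      D′ : Subset (suc m + E)
      D′ = (D - sub e) ∪ ⁅ centre ⁆

      ℓ∉D′ : leaf (leafOf e) ∉ D′
      ℓ∉D′ ℓ∈D′ with x∈p-y∪⁅u⁆⁻ D (sub e) centre ℓ∈D′
      ... | inj₁ (ℓ∈D , _) = ℓ∉D ℓ∈D
      ... | inj₂ ℓ≡centre  = 0≢1+n (sym (orig-injective ℓ≡centre))

      undominated : ¬ ∃ λ x → x ∈ D′ × Adj H x (leaf (leafOf e))
      undominated (x , x∈D′ , x~ℓ) with vertexView x
      ... | original v     = orig-nonadjacent v _ x~ℓ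
      ... | subdividing e′ with leafOf-injective (sub-leaf-adjacent⁻ x~ℓ) | x∈p-y∪⁅u⁆⁻ D (sub e) centre x∈D′
      ...   | refl | inj₁ (_ , e≢e)  = e≢e refl
      ...   | refl | inj₂ e≡centre   = orig≢sub zero e (sym e≡centre)

    spare : ∃ λ x → x ∈ D × ∀ j → ¬ Guards j x
    spare with centre ∈? D
    ... | yes c∈D = centre , c∈D , λ { j (inj₁ c≡j) → 0≢1+n (orig-injective c≡j)
                                     ; j (inj₂ (_ , e , c≡e , _)) → orig≢sub zero e c≡e }
    ... | no  c∉D with proj₂ D-secure centre c∉D
    ...   | x , x∈D , c~x , swapped-dominating with vertexView x
    ...     | original v    = ⊥-elim (orig-nonadjacent zero v c~x)
    ...     | subdividing e = sub e , x∈D , unguarded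
      where
      unguarded : ∀ j → ¬ Guards j (sub e)
      unguarded j (inj₁ e≡j) = orig≢sub (suc j) e (sym e≡j)
      unguarded j (inj₂ (j∉D , e′ , e≡e′ , refl)) with sub-injective e≡e′
      ... | refl = j∉D (defender-leaf∈D e swapped-dominating)

    secureDominating⇒suc-m≤∣D∣ : suc m ≤ ∣ D ∣
    secureDominating⇒suc-m≤∣D∣ = injective⇒≤∣p∣ witness witness-injective witness∈D
      where
      witness : Fin (suc m) → Fin (suc m + E)
      witness zero    = proj₁ spare
      witness (suc j) = proj₁ (guard j)

      witness∈D : ∀ i → witness i ∈ D
      witness∈D zero    = proj₁ (proj₂ spare)
      witness∈D (suc j) = proj₁ (proj₂ (guard j))

      guarded : ∀ j → Guards j (witness (suc j))
      guarded j = proj₂ (proj₂ (guard j))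

      witness-injective : Injective _≡_ _≡_ witness
      witness-injective {zero}  {zero}  _  = refl
      witness-injective {zero}  {suc j} eq = ⊥-elim (proj₂ (proj₂ spare) j (subst (Guards j) (sym eq) (guarded j)))
      witness-injective {suc i} {zero}  eq = ⊥-elim (proj₂ (proj₂ spare) i (subst (Guards i) eq (guarded i)))
      witness-injective {suc i} {suc j} eq = cong suc (guards-unique (guarded i) (subst (Guards j) (sym eq) (guarded j)))

proposition2p4 : ∀ (m : ℕ) → IsSecureDominationNumber (subdivide2 (star (suc m))) (suc m)
proposition2p4 m = (originals , originals-secure , ∣originals∣≡n) , λ D → secureDominating⇒suc-m≤∣D∣
  where open SubdividedStar m
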